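{- The ordinary generating function $I(x) = \sum_{n\ge 0} i_n x^n$ of interval graphs has radius of convergence zero.
   Context: A finite undirected simple graph is an interval graph if there is a one-to-one correspondence between its vertices and a set of intervals of the real line such that two distinct vertices are adjacent if and only if their corresponding intervals have non-empty intersection. For each integer $n\ge 0$, $i_n$ denotes the number of isomorphism classes of interval graphs with exactly $n$ vertices. -}

module Defs where

open import Data.Nat using (ℕ)
open import Data.Fin using (Fin)
open import Data.Bool using (Bool; true)
open import Data.Rational using (ℚ; _≤_)
open import Data.Product using (Σ; _×_; ∃-syntax; _,_)
open import Relation.Binary.PropositionalEquality using (_≡_)
open import Relation.Nullary using (¬_)
open import Function.Bundles using (_↔_; Inverse; _⇔_)

record Graph (n : ℕ) : Set where
  field
    adj   : Fin n → Fin n → Bool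
    sym   : ∀ i j → adj i j ≡ adj j i
    irrefl : ∀ i → ¬ (adj i i ≡ true)
open Graph public

_≅_ : ∀ {n} → Graph n → Graph n → Set
_≅_ {n} G H = Σ (Fin n ↔ Fin n) λ σ →
  ∀ i j → adj G i j ≡ adj H (Inverse.to σ i) (Inverse.to σ j)

IsIntervalGraph : ∀ {n} → Graph n → Set
IsIntervalGraph {n} G =
  Σ (Fin n → ℚ) λ a → Σ (Fin n → ℚ) λ b →
    (∀ i → a i ≤ b i) ×
    (∀ i j → ¬ (i ≡ j) → ¬ ((a i , b i) ≡ (a j , b j))) ×
    (∀ i j → ¬ (i ≡ j) →
      (adj G i j ≡ true) ⇔ (∃[ q ] ((a i ≤ q × q ≤ b i) × (a j ≤ q × q ≤ b j))))

-- "i_n ≥ m": there are m pairwise non-isomorphic interval graphs on n vertices,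
-- i.e. the set of isomorphism classes of n-vertex interval graphs has at least m elements.
AtLeastIntervalClasses : ℕ → ℕ → Set
AtLeastIntervalClasses n m =
  Σ (Fin m → Graph n) λ G →
    (∀ k → IsIntervalGraph (G k)) ×
    (∀ k l → ¬ (k ≡ l) → ¬ (G k ≅ G l))

{-# OPTIONS --safe #-}
-- For f : Fin m → Fin m take the interval graph on 3m + 3 vertices made of a clique I 0 … I (m-1),
-- points L 0 … L m with L j adjacent to I i iff i < j, and a clique R 0 … R (m+1) with R t
-- adjacent to I i iff t ≤ f i + 1.  The L j are exactly the vertices of degree ≤ m, L j having
-- degree j, so an isomorphism fixes every L j.  The neighbours of L j are I 0 … I (j-1), so the
-- sums of the degrees of the neighbours of L j and L (j+1) differ by the degree of I j, which is
-- f j plus a quantity independent of f.  Hence the m ^ m graphs are pairwise non-isomorphic and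
-- i (3m+3) ≥ m ^ m, which exceeds M (k+1) ^ (3m+3) once m = (M+1) (k+1) ^ 6.
module Submission where

open import Defs
open import Data.Nat using (ℕ; _*_; _^_; suc)
open import Data.Product using (∃-syntax)

open import Data.Bool.Base using (Bool; true; false; not; if_then_else_; T)
open import Data.Bool.Properties using (T-≡)
open import Data.Empty using (⊥-elim)
open import Data.Fin.Base
  using (Fin; zero; suc; toℕ; _↑ˡ_; _↑ʳ_; splitAt; inject₁; inject≤; combine; finToFun; funToFin)
open import Data.Fin.Permutation using (_⟨$⟩ʳ_)
open import Data.Fin.Properties
  using (toℕ-injective; toℕ<n; toℕ≤pred[n]; toℕ-inject₁; splitAt-↑ˡ; splitAt-↑ʳ; splitAt⁻¹-↑ˡ; splitAt⁻¹-↑ʳ;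
         inject≤-injective; funToFin-finToFin)
import Data.Integer.Base as ℤ
import Data.Integer.Properties as ℤ
open import Data.Nat.Base
  using (zero; _+_; _≤_; _≰_; _<_; _<ᵇ_; _≡ᵇ_; pred; _⊔_; s≤s; s≤s⁻¹; NonZero; >-nonZero⁻¹)
open import Data.Nat.Coprimality using (1-coprimeTo) renaming (sym to coprime-sym)
open import Data.Nat.Properties
  using (+-0-commutativeMonoid; *-commutativeSemigroup; +-assoc; +-comm; +-identityʳ; +-cancelˡ-≡; +-cancelˡ-≤;
         +-monoˡ-≤; +-monoʳ-≤; *-monoˡ-≤; *-monoʳ-≤; *-suc; ^-monoˡ-≤; ^-monoʳ-≤; ^-identityʳ; ^-*-assoc;
         m^n>0; m^n≢0; suc-injective; ≤-refl; ≤-trans; ≤-reflexive; ≤-antisym; <⇒≤; <⇒≱; ≤⇒≯;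
         m≤m⊔n; m≤n⊔m; ⊔-lub; m≤m+n; m≤n+m; m≤n⇒m≤1+n; m≤n⇒m≤n+o; m+n≤o⇒m≤o; <ᵇ⇒<; <⇒<ᵇ; ≡ᵇ⇒≡;
         module ≤-Reasoning)
open import Data.Nat.Solver using (module +-*-Solver)
open import Data.Product using (_×_; _,_; proj₁; proj₂)
open import Data.Rational.Base using (ℚ; mkℚ; *≤*) renaming (_≤_ to _≤ℚ_)
import Data.Rational.Properties as ℚ
open import Data.Sum.Base using (inj₁; inj₂; [_,_]′)
open import Data.Unit.Base using (tt)
open import Function.Base using (_∘_)
open import Function.Bundles using (_⇔_; mk⇔)
import Function.Properties.Equivalence as ⇔
open import Relation.Binary.PropositionalEquality
  using (_≡_; _≢_; _≗_; refl; trans; cong; cong₂; subst; subst₂; module ≡-Reasoning)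
  renaming (sym to ≡-sym)

open import Algebra.Properties.CommutativeMonoid.Sum +-0-commutativeMonoid
  using (sum-syntax; sum-cong-≗; sum-permute; sum-replicate-zero)
open import Algebra.Properties.CommutativeSemigroup *-commutativeSemigroup using (interchange)

≡ᵇ-refl : ∀ a → (a ≡ᵇ a) ≡ true
≡ᵇ-refl zero    = refl
≡ᵇ-refl (suc a) = ≡ᵇ-refl a

≡ᵇ-sym : ∀ a b → (a ≡ᵇ b) ≡ (b ≡ᵇ a)
≡ᵇ-sym zero    zero    = refl
≡ᵇ-sym zero    (suc b) = refl
≡ᵇ-sym (suc a) zero    = refl
≡ᵇ-sym (suc a) (suc b) = ≡ᵇ-sym a b

m≤n⇒m≤1+n+o : ∀ {m n} o → m ≤ n → m ≤ suc n + o
m≤n⇒m≤1+n+o o m≤n = m≤n⇒m≤1+n (m≤n⇒m≤n+o o m≤n)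

m≤n⇒1+n+o≰m : ∀ {m n} o → m ≤ n → suc n + o ≰ m
m≤n⇒1+n+o≰m {n = n} o m≤n 1+n+o≤m = ≤⇒≯ m≤n (m+n≤o⇒m≤o (suc n) 1+n+o≤m)

≢⇒not-≡ᵇ : ∀ {a b} → a ≢ b → T (not (a ≡ᵇ b))
≢⇒not-≡ᵇ {a} {b} a≢b with a ≡ᵇ b in a≡ᵇb
... | true  = a≢b (≡ᵇ⇒≡ a b (subst T (≡-sym a≡ᵇb) tt))
... | false = tt

^-distribʳ-* : ∀ a b n → (a * b) ^ n ≡ a ^ n * b ^ n
^-distribʳ-* a b zero    = refl
^-distribʳ-* a b (suc n) =
  trans (cong (a * b *_) (^-distribʳ-* a b n)) (interchange a b (a ^ n) (b ^ n))

M*C^m<m^m : ∀ M C m .{{_ : NonZero C}} → suc M * C ≤ m → M * C ^ m < m ^ m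
M*C^m<m^m M C m 1+M*C≤m = begin
  suc (M * C ^ m)    ≤⟨ +-monoˡ-≤ (M * C ^ m) (m^n>0 C m) ⟩
  suc M * C ^ m      ≤⟨ *-monoˡ-≤ (C ^ m) 1+M≤[1+M]^m ⟩
  suc M ^ m * C ^ m  ≡⟨ ^-distribʳ-* (suc M) C m ⟨
  (suc M * C) ^ m    ≤⟨ ^-monoˡ-≤ m 1+M*C≤m ⟩
  m ^ m              ∎
  where
  open ≤-Reasoning
  1≤m : 1 ≤ m
  1≤m = ≤-trans (>-nonZero⁻¹ C) (≤-trans (m≤m+n C (M * C)) 1+M*C≤m)
  1+M≤[1+M]^m : suc M ≤ suc M ^ m
  1+M≤[1+M]^m = ≤-trans (≤-reflexive (≡-sym (^-identityʳ (suc M)))) (^-monoʳ-≤ (suc M) 1≤m)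

sum-↑ : ∀ a {b} (h : Fin (a + b) → ℕ) →
        ∑[ u < a + b ] h u ≡ ∑[ i < a ] h (i ↑ˡ b) + ∑[ j < b ] h (a ↑ʳ j)
sum-↑ zero    h = refl
sum-↑ (suc a) h = trans (cong (h zero +_) (sum-↑ a (h ∘ suc))) (≡-sym (+-assoc (h zero) _ _))

sum-1 : ∀ n → ∑[ i < n ] 1 ≡ n
sum-1 zero    = refl
sum-1 (suc n) = cong suc (sum-1 n)

prefixSum : ∀ {n} → (Fin n → ℕ) → ℕ → ℕ
prefixSum {n} w k = ∑[ i < n ] (if toℕ i <ᵇ k then w i else 0)

prefixSum-suc : ∀ {n} (w : Fin n → ℕ) (i : Fin n) →
                prefixSum w (suc (toℕ i)) ≡ prefixSum w (toℕ i) + w i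
prefixSum-suc w zero    = +-comm (w zero) _
prefixSum-suc w (suc i) =
  trans (cong (w zero +_) (prefixSum-suc (w ∘ suc) i)) (≡-sym (+-assoc (w zero) _ _))

prefixSum-1 : ∀ {n} k → k ≤ n → prefixSum {n} (λ _ → 1) k ≡ k
prefixSum-1 {zero}  zero    _         = refl
prefixSum-1 {suc n} zero    _         = sum-replicate-zero n
prefixSum-1 {suc n} (suc k) (s≤s k≤n) = cong suc (prefixSum-1 k k≤n)

count-≢ : ∀ {n} (i : Fin n) → ∑[ i′ < n ] (if not (toℕ i ≡ᵇ toℕ i′) then 1 else 0) ≡ pred n
count-≢ {suc n}       zero    = sum-1 n
count-≢ {suc (suc n)} (suc i) = cong suc (count-≢ i)

funToFin-cong : ∀ {d b} {f g : Fin d → Fin b} → f ≗ g → funToFin f ≡ funToFin g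
funToFin-cong {zero}  _   = refl
funToFin-cong {suc d} f≗g = cong₂ combine (f≗g zero) (funToFin-cong (f≗g ∘ suc))

finToFun-injective : ∀ {b d} {x y : Fin (b ^ d)} → finToFun {b} {d} x ≗ finToFun y → x ≡ y
finToFun-injective {b} {d} {x} {y} eq = begin
  x                              ≡⟨ funToFin-finToFin {d} {b} x ⟨
  funToFin {d} {b} (finToFun x)  ≡⟨ funToFin-cong eq ⟩
  funToFin {d} {b} (finToFun y)  ≡⟨ funToFin-finToFin {d} {b} y ⟩
  y                              ∎
  where open ≡-Reasoning

atLeastIntervalClasses : ∀ {n d b N} (G : (Fin d → Fin b) → Graph n) →
                         (∀ f → IsIntervalGraph (G f)) →
                         (∀ {f g} → G f ≅ G g → f ≗ g) →
                         N ≤ b ^ d → AtLeastIntervalClasses n N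
atLeastIntervalClasses {d = d} {b} {N} G interval rigid N≤b^d =
  G ∘ code , interval ∘ code ,
  λ k l k≢l → k≢l ∘ inject≤-injective N≤b^d N≤b^d k l ∘ finToFun-injective ∘ rigid
  where
  code : Fin N → Fin d → Fin b
  code k = finToFun {b} {d} (inject≤ k N≤b^d)

neighbourSum : ∀ {n} → Graph n → (Fin n → ℕ) → Fin n → ℕ
neighbourSum {n} G w u = ∑[ v < n ] (if adj G u v then w v else 0)

degree : ∀ {n} → Graph n → Fin n → ℕ
degree G = neighbourSum G (λ _ → 1)

neighbourSum-≅ : ∀ {n} {G H : Graph n} (iso : G ≅ H) {w w′ : Fin n → ℕ} →
                 (∀ v → w v ≡ w′ (proj₁ iso ⟨$⟩ʳ v)) →
                 ∀ u → neighbourSum G w u ≡ neighbourSum H w′ (proj₁ iso ⟨$⟩ʳ u)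
neighbourSum-≅ {n} {G} {H} (σ , adj-σ) {w} {w′} w≡w′∘σ u = begin
  ∑[ v < n ] (if adj G u v then w v else 0)
    ≡⟨ sum-cong-≗ (λ v → cong₂ (λ b x → if b then x else 0) (adj-σ u v) (w≡w′∘σ v)) ⟩
  ∑[ v < n ] (if adj H (σ ⟨$⟩ʳ u) (σ ⟨$⟩ʳ v) then w′ (σ ⟨$⟩ʳ v) else 0)
    ≡⟨ sum-permute _ σ ⟨
  ∑[ v < n ] (if adj H (σ ⟨$⟩ʳ u) v then w′ v else 0) ∎
  where open ≡-Reasoning

degree-≅ : ∀ {n} {G H : Graph n} (iso : G ≅ H) → ∀ u → degree G u ≡ degree H (proj₁ iso ⟨$⟩ʳ u)
degree-≅ {G = G} {H} iso = neighbourSum-≅ {G = G} {H} iso (λ _ → refl)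

fromℕ : ℕ → ℚ
fromℕ n = mkℚ (ℤ.+ n) 0 (coprime-sym (1-coprimeTo n))

fromℕ-mono-≤ : ∀ {a b} → a ≤ b → fromℕ a ≤ℚ fromℕ b
fromℕ-mono-≤ {a} {b} a≤b =
  *≤* (subst₂ ℤ._≤_ (≡-sym (ℤ.*-identityʳ (ℤ.+ a))) (≡-sym (ℤ.*-identityʳ (ℤ.+ b))) (ℤ.+≤+ a≤b))

fromℕ-cancel-≤ : ∀ {a b} → fromℕ a ≤ℚ fromℕ b → a ≤ b
fromℕ-cancel-≤ {a} {b} (*≤* a≤b) =
  ℤ.drop‿+≤+ (subst₂ ℤ._≤_ (ℤ.*-identityʳ (ℤ.+ a)) (ℤ.*-identityʳ (ℤ.+ b)) a≤b)

fromℕ-injective : ∀ {a b} → fromℕ a ≡ fromℕ b → a ≡ b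
fromℕ-injective = ℤ.+-injective ∘ cong ℚ.numerator

isIntervalGraph-ℕ : ∀ {n} (G : Graph n) (lo hi : Fin n → ℕ) →
                    (∀ u → lo u ≤ hi u) →
                    (∀ u v → lo u ≡ lo v → hi u ≡ hi v → u ≡ v) →
                    (∀ u v → u ≢ v → T (adj G u v) ⇔ (lo u ≤ hi v × lo v ≤ hi u)) →
                    IsIntervalGraph G
isIntervalGraph-ℕ {n} G lo hi lo≤hi endpoints-injective adj⇔overlap =
  fromℕ ∘ lo , fromℕ ∘ hi , fromℕ-mono-≤ ∘ lo≤hi , distinct ,
  λ u v u≢v → ⇔.trans (⇔.sym T-≡) (⇔.trans (adj⇔overlap u v u≢v) (overlap⇔meet u v))
  where
  distinct : ∀ u v → u ≢ v → (fromℕ (lo u) , fromℕ (hi u)) ≢ (fromℕ (lo v) , fromℕ (hi v))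
  distinct u v u≢v eq =
    u≢v (endpoints-injective u v (fromℕ-injective (cong proj₁ eq)) (fromℕ-injective (cong proj₂ eq)))

  _∈_ : ℚ → Fin n → Set
  q ∈ u = fromℕ (lo u) ≤ℚ q × q ≤ℚ fromℕ (hi u)

  overlap⇔meet : ∀ u v → (lo u ≤ hi v × lo v ≤ hi u) ⇔ (∃[ q ] (q ∈ u × q ∈ v))
  overlap⇔meet u v = mk⇔
    (λ (lu≤hv , lv≤hu) → fromℕ (lo u ⊔ lo v) ,
      (fromℕ-mono-≤ (m≤m⊔n _ _) , fromℕ-mono-≤ (⊔-lub (lo≤hi u) lv≤hu)) ,
      (fromℕ-mono-≤ (m≤n⊔m _ _) , fromℕ-mono-≤ (⊔-lub lu≤hv (lo≤hi v))))
    (λ (q , (lu≤q , q≤hu) , (lv≤q , q≤hv)) →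
      fromℕ-cancel-≤ (ℚ.≤-trans lu≤q q≤hv) , fromℕ-cancel-≤ (ℚ.≤-trans lv≤q q≤hu))

data Vertex (m : ℕ) : Set where
  I : Fin m → Vertex m
  L : Fin (suc m) → Vertex m
  R : Fin (suc (suc m)) → Vertex m

order : ℕ → ℕ
order m = m + (suc m + suc (suc m))

order≤6* : ∀ {m} → 1 ≤ m → order m ≤ 6 * m
order≤6* {suc m} _ = begin
  order (suc m)  ≡⟨ solve 1 (λ m → (con 1 :+ m) :+ ((con 2 :+ m) :+ (con 3 :+ m)) := con 6 :+ con 3 :* m) refl m ⟩
  6 + 3 * m      ≤⟨ +-monoʳ-≤ 6 (*-monoˡ-≤ m (m≤m+n 3 3)) ⟩
  6 + 6 * m      ≡⟨ *-suc 6 m ⟨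
  6 * suc m      ∎
  where
  open ≤-Reasoning
  open +-*-Solver

decode : ∀ {m} → Fin (order m) → Vertex m
decode {m} u = [ I , [ L , R ]′ ∘ splitAt (suc m) ]′ (splitAt m u)

encode : ∀ {m} → Vertex m → Fin (order m)
encode {m} (I i) = i ↑ˡ (suc m + suc (suc m))
encode {m} (L j) = m ↑ʳ (j ↑ˡ suc (suc m))
encode {m} (R t) = m ↑ʳ (suc m ↑ʳ t)

decode-encode : ∀ {m} (x : Vertex m) → decode (encode x) ≡ x
decode-encode {m} (I i) rewrite splitAt-↑ˡ m i (suc m + suc (suc m)) = refl
decode-encode {m} (L j) rewrite splitAt-↑ʳ m (suc m + suc (suc m)) (j ↑ˡ suc (suc m))
                              | splitAt-↑ˡ (suc m) j (suc (suc m)) = refl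
decode-encode {m} (R t) rewrite splitAt-↑ʳ m (suc m + suc (suc m)) (suc m ↑ʳ t)
                              | splitAt-↑ʳ (suc m) (suc (suc m)) t = refl

encode-decode : ∀ {m} (u : Fin (order m)) → encode (decode u) ≡ u
encode-decode {m} u with splitAt m u in split-u
... | inj₁ i = splitAt⁻¹-↑ˡ split-u
... | inj₂ w with splitAt (suc m) w in split-w
...   | inj₁ j = trans (cong (m ↑ʳ_) (splitAt⁻¹-↑ˡ split-w)) (splitAt⁻¹-↑ʳ split-u)
...   | inj₂ t = trans (cong (m ↑ʳ_) (splitAt⁻¹-↑ʳ split-w)) (splitAt⁻¹-↑ʳ split-u)

decode-injective : ∀ {m} {u v : Fin (order m)} → decode u ≡ decode v → u ≡ v
decode-injective {u = u} {v} eq =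
  trans (≡-sym (encode-decode u)) (trans (cong encode eq) (encode-decode v))

sumV : ∀ {m} → (Vertex m → ℕ) → ℕ
sumV {m} h = ∑[ i < m ] h (I i) + (∑[ j < suc m ] h (L j) + ∑[ t < suc (suc m) ] h (R t))

sumV-R≤ : ∀ {m} (h : Vertex m → ℕ) → ∑[ t < suc (suc m) ] h (R t) ≤ sumV h
sumV-R≤ {m} h =
  ≤-trans (m≤n+m (∑[ t < suc (suc m) ] h (R t)) (∑[ j < suc m ] h (L j)))
          (m≤n+m _ (∑[ i < m ] h (I i)))

sum-decode : ∀ {m} (h : Vertex m → ℕ) → ∑[ u < order m ] h (decode u) ≡ sumV h
sum-decode {m} h =
  trans (sum-↑ m (h ∘ decode))
    (cong₂ _+_ (sum-cong-≗ (cong h ∘ decode-encode ∘ I))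
      (trans (sum-↑ (suc m) (h ∘ decode ∘ (m ↑ʳ_)))
        (cong₂ _+_ (sum-cong-≗ (cong h ∘ decode-encode ∘ L)) (sum-cong-≗ (cong h ∘ decode-encode ∘ R)))))

module _ {m : ℕ} (f : Fin m → Fin m) where

  adjV : Vertex m → Vertex m → Bool
  adjV (I i) (I i′) = not (toℕ i ≡ᵇ toℕ i′)
  adjV (I i) (L j)  = toℕ i <ᵇ toℕ j
  adjV (I i) (R t)  = toℕ t <ᵇ suc (suc (toℕ (f i)))
  adjV (L j) (I i)  = toℕ i <ᵇ toℕ j
  adjV (L _) (L _)  = false
  adjV (L _) (R _)  = false
  adjV (R t) (I i)  = toℕ t <ᵇ suc (suc (toℕ (f i)))
  adjV (R _) (L _)  = false
  adjV (R t) (R t′) = not (toℕ t ≡ᵇ toℕ t′)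

  adjV-sym : ∀ x y → adjV x y ≡ adjV y x
  adjV-sym (I i) (I i′) = cong not (≡ᵇ-sym (toℕ i) (toℕ i′))
  adjV-sym (I _) (L _)  = refl
  adjV-sym (I _) (R _)  = refl
  adjV-sym (L _) (I _)  = refl
  adjV-sym (L _) (L _)  = refl
  adjV-sym (L _) (R _)  = refl
  adjV-sym (R _) (I _)  = refl
  adjV-sym (R _) (L _)  = refl
  adjV-sym (R t) (R t′) = cong not (≡ᵇ-sym (toℕ t) (toℕ t′))

  adjV-irrefl : ∀ x → adjV x x ≢ true
  adjV-irrefl (I i) rewrite ≡ᵇ-refl (toℕ i) = λ ()
  adjV-irrefl (L _) = λ ()
  adjV-irrefl (R t) rewrite ≡ᵇ-refl (toℕ t) = λ ()

  functionGraph : Graph (order m)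
  functionGraph = record
    { adj    = λ u v → adjV (decode u) (decode v)
    ; sym    = λ u v → adjV-sym (decode u) (decode v)
    ; irrefl = adjV-irrefl ∘ decode
    }

  lo hi : Vertex m → ℕ
  lo (I i) = suc (toℕ i)
  lo (L j) = toℕ j
  lo (R t) = suc m + toℕ t
  hi (I i) = suc m + suc (toℕ (f i))
  hi (L j) = toℕ j
  hi (R t) = suc m + suc m

  lo≤hi : ∀ x → lo x ≤ hi x
  lo≤hi (I i) = m≤n⇒m≤1+n+o _ (toℕ<n i)
  lo≤hi (L j) = ≤-refl
  lo≤hi (R t) = +-monoʳ-≤ (suc m) (toℕ≤pred[n] t)

  endpoints-injective : ∀ x y → lo x ≡ lo y → hi x ≡ hi y → x ≡ y
  endpoints-injective (I i) (I i′) lo≡ _   = cong I (toℕ-injective (suc-injective lo≡))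
  endpoints-injective (I i) (L j)  _   hi≡ = ⊥-elim (m≤n⇒1+n+o≰m _ (toℕ≤pred[n] j) (≤-reflexive hi≡))
  endpoints-injective (I i) (R t)  lo≡ _   = ⊥-elim (m≤n⇒1+n+o≰m _ (toℕ<n i) (≤-reflexive (≡-sym lo≡)))
  endpoints-injective (L j) (I i)  _   hi≡ = ⊥-elim (m≤n⇒1+n+o≰m _ (toℕ≤pred[n] j) (≤-reflexive (≡-sym hi≡)))
  endpoints-injective (L j) (L j′) lo≡ _   = cong L (toℕ-injective lo≡)
  endpoints-injective (L j) (R t)  lo≡ _   = ⊥-elim (m≤n⇒1+n+o≰m _ (toℕ≤pred[n] j) (≤-reflexive (≡-sym lo≡)))
  endpoints-injective (R t) (I i)  lo≡ _   = ⊥-elim (m≤n⇒1+n+o≰m _ (toℕ<n i) (≤-reflexive lo≡))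
  endpoints-injective (R t) (L j)  lo≡ _   = ⊥-elim (m≤n⇒1+n+o≰m _ (toℕ≤pred[n] j) (≤-reflexive lo≡))
  endpoints-injective (R t) (R t′) lo≡ _   = cong R (toℕ-injective (+-cancelˡ-≡ (suc m) _ _ lo≡))

  adjV⇒overlap : ∀ x y → T (adjV x y) → lo x ≤ hi y × lo y ≤ hi x
  adjV⇒overlap (I i) (I i′) _ = m≤n⇒m≤1+n+o _ (toℕ<n i) , m≤n⇒m≤1+n+o _ (toℕ<n i′)
  adjV⇒overlap (I i) (L j)  i<j = <ᵇ⇒< _ _ i<j , m≤n⇒m≤1+n+o _ (toℕ≤pred[n] j)
  adjV⇒overlap (I i) (R t)  t≤1+fi = m≤n⇒m≤1+n+o _ (toℕ<n i) , +-monoʳ-≤ (suc m) (s≤s⁻¹ (<ᵇ⇒< _ _ t≤1+fi))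
  adjV⇒overlap (L j) (I i)  i<j = m≤n⇒m≤1+n+o _ (toℕ≤pred[n] j) , <ᵇ⇒< _ _ i<j
  adjV⇒overlap (R t) (I i)  t≤1+fi = +-monoʳ-≤ (suc m) (s≤s⁻¹ (<ᵇ⇒< _ _ t≤1+fi)) , m≤n⇒m≤1+n+o _ (toℕ<n i)
  adjV⇒overlap (R t) (R t′) _ = +-monoʳ-≤ (suc m) (toℕ≤pred[n] t) , +-monoʳ-≤ (suc m) (toℕ≤pred[n] t′)

  overlap⇒adjV : ∀ x y → x ≢ y → lo x ≤ hi y × lo y ≤ hi x → T (adjV x y)
  overlap⇒adjV (I i) (I i′) x≢y _       = ≢⇒not-≡ᵇ (x≢y ∘ cong I ∘ toℕ-injective)
  overlap⇒adjV (I i) (L j)  _   (i<j , _) = <⇒<ᵇ i<j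
  overlap⇒adjV (I i) (R t)  _   (_ , q) = <⇒<ᵇ (s≤s (+-cancelˡ-≤ (suc m) _ _ q))
  overlap⇒adjV (L j) (I i)  _   (_ , i<j) = <⇒<ᵇ i<j
  overlap⇒adjV (L j) (L j′) x≢y (p , q) = ⊥-elim (x≢y (cong L (toℕ-injective (≤-antisym p q))))
  overlap⇒adjV (L j) (R t)  _   (_ , q) = ⊥-elim (m≤n⇒1+n+o≰m _ (toℕ≤pred[n] j) q)
  overlap⇒adjV (R t) (I i)  _   (p , _) = <⇒<ᵇ (s≤s (+-cancelˡ-≤ (suc m) _ _ p))
  overlap⇒adjV (R t) (L j)  _   (p , _) = ⊥-elim (m≤n⇒1+n+o≰m _ (toℕ≤pred[n] j) p)
  overlap⇒adjV (R t) (R t′) x≢y _       = ≢⇒not-≡ᵇ (x≢y ∘ cong R ∘ toℕ-injective)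

  functionGraph-isInterval : IsIntervalGraph functionGraph
  functionGraph-isInterval =
    isIntervalGraph-ℕ functionGraph (lo ∘ decode) (hi ∘ decode) (lo≤hi ∘ decode)
      (λ u v lo≡ hi≡ → decode-injective (endpoints-injective (decode u) (decode v) lo≡ hi≡))
      (λ u v u≢v → mk⇔ (adjV⇒overlap (decode u) (decode v))
                        (overlap⇒adjV (decode u) (decode v) (u≢v ∘ decode-injective)))

  neighbourSumV : (Vertex m → ℕ) → Vertex m → ℕ
  neighbourSumV w x = sumV (λ y → if adjV x y then w y else 0)

  degreeV : Vertex m → ℕ
  degreeV = neighbourSumV (λ _ → 1)

  neighbourSum-decode : ∀ w u → neighbourSum functionGraph (w ∘ decode) u ≡ neighbourSumV w (decode u)
  neighbourSum-decode w u = sum-decode (λ y → if adjV (decode u) y then w y else 0)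

  neighbourSumV-L : ∀ w j → neighbourSumV w (L j) ≡ prefixSum (w ∘ I) (toℕ j)
  neighbourSumV-L w j =
    trans (cong (prefixSum (w ∘ I) (toℕ j) +_)
                (cong₂ _+_ (sum-replicate-zero (suc m)) (sum-replicate-zero (suc (suc m)))))
          (+-identityʳ _)

  degreeV-L : ∀ j → degreeV (L j) ≡ toℕ j
  degreeV-L j = trans (neighbourSumV-L (λ _ → 1) j) (prefixSum-1 (toℕ j) (toℕ≤pred[n] j))

  degreeV-I : ∀ i → degreeV (I i) ≡
              pred m + (∑[ j < suc m ] (if toℕ i <ᵇ toℕ j then 1 else 0) + suc (suc (toℕ (f i))))
  degreeV-I i =
    cong₂ _+_ (count-≢ i)
      (cong (∑[ j < suc m ] (if toℕ i <ᵇ toℕ j then 1 else 0) +_)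
            (prefixSum-1 _ (s≤s (s≤s (<⇒≤ (toℕ<n (f i)))))))

m<degreeV-I : ∀ {m} (f : Fin m → Fin m) i → m < degreeV f (I i)
m<degreeV-I {suc m} f i =
  ≤-trans (≤-reflexive (+-comm 2 m))
    (≤-trans (+-monoʳ-≤ m (≤-trans (m≤m+n 2 _) (m≤n+m _ _))) (≤-reflexive (≡-sym (degreeV-I f i))))

m<degreeV-R : ∀ {m} (f : Fin m → Fin m) t → m < degreeV f (R t)
m<degreeV-R f t =
  ≤-trans (≤-reflexive (≡-sym (count-≢ t))) (sumV-R≤ (λ y → if adjV f (R t) y then 1 else 0))

degreeV≡toℕ⇒L : ∀ {m} (f : Fin m → Fin m) {j : Fin (suc m)} x → degreeV f x ≡ toℕ j → x ≡ L j
degreeV≡toℕ⇒L f {j} (I i)  eq = ⊥-elim (<⇒≱ (m<degreeV-I f i) (≤-trans (≤-reflexive eq) (toℕ≤pred[n] j)))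
degreeV≡toℕ⇒L f     (L j′) eq = cong L (toℕ-injective (trans (≡-sym (degreeV-L f j′)) eq))
degreeV≡toℕ⇒L f {j} (R t)  eq = ⊥-elim (<⇒≱ (m<degreeV-R f t) (≤-trans (≤-reflexive eq) (toℕ≤pred[n] j)))

degreeV-I-injective : ∀ {m} (f g : Fin m → Fin m) i → degreeV f (I i) ≡ degreeV g (I i) → f i ≡ g i
degreeV-I-injective {m} f g i eq =
  toℕ-injective (suc-injective (suc-injective (+-cancelˡ-≡ L-neighbours _ _ (+-cancelˡ-≡ (pred m) _ _
    (trans (≡-sym (degreeV-I f i)) (trans eq (degreeV-I g i)))))))
  where
  L-neighbours : ℕ
  L-neighbours = ∑[ j < suc m ] (if toℕ i <ᵇ toℕ j then 1 else 0)

module _ {m} {f g : Fin m → Fin m} (iso : functionGraph f ≅ functionGraph g) where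

  open ≡-Reasoning

  private
    σ : Fin (order m) → Fin (order m)
    σ = proj₁ iso ⟨$⟩ʳ_

  degreeV-preserved : ∀ u → degreeV f (decode u) ≡ degreeV g (decode (σ u))
  degreeV-preserved u = begin
    degreeV f (decode u)            ≡⟨ neighbourSum-decode f (λ _ → 1) u ⟨
    degree (functionGraph f) u      ≡⟨ degree-≅ {G = functionGraph f} {functionGraph g} iso u ⟩
    degree (functionGraph g) (σ u)  ≡⟨ neighbourSum-decode g (λ _ → 1) (σ u) ⟩
    degreeV g (decode (σ u))        ∎

  ≅-fixes-L : ∀ j → decode (σ (encode (L j))) ≡ L j
  ≅-fixes-L j = degreeV≡toℕ⇒L g _ (begin
    degreeV g (decode (σ (encode (L j))))  ≡⟨ degreeV-preserved (encode (L j)) ⟨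
    degreeV f (decode (encode (L j)))      ≡⟨ cong (degreeV f) (decode-encode (L j)) ⟩
    degreeV f (L j)                        ≡⟨ degreeV-L f j ⟩
    toℕ j                                  ∎)

  prefixDegrees-preserved : ∀ j → prefixSum (degreeV f ∘ I) (toℕ j) ≡ prefixSum (degreeV g ∘ I) (toℕ j)
  prefixDegrees-preserved j = begin
    prefixSum (degreeV f ∘ I) (toℕ j)
      ≡⟨ neighbourSumV-L f (degreeV f) j ⟨
    neighbourSumV f (degreeV f) (L j)
      ≡⟨ cong (neighbourSumV f (degreeV f)) (decode-encode (L j)) ⟨
    neighbourSumV f (degreeV f) (decode (encode (L j)))
      ≡⟨ neighbourSum-decode f (degreeV f) (encode (L j)) ⟨
    neighbourSum (functionGraph f) (degreeV f ∘ decode) (encode (L j))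
      ≡⟨ neighbourSum-≅ {G = functionGraph f} {functionGraph g} iso degreeV-preserved (encode (L j)) ⟩
    neighbourSum (functionGraph g) (degreeV g ∘ decode) (σ (encode (L j)))
      ≡⟨ neighbourSum-decode g (degreeV g) (σ (encode (L j))) ⟩
    neighbourSumV g (degreeV g) (decode (σ (encode (L j))))
      ≡⟨ cong (neighbourSumV g (degreeV g)) (≅-fixes-L j) ⟩
    neighbourSumV g (degreeV g) (L j)
      ≡⟨ neighbourSumV-L g (degreeV g) j ⟩
    prefixSum (degreeV g ∘ I) (toℕ j)
      ∎

  degreeV-I-preserved : ∀ i → degreeV f (I i) ≡ degreeV g (I i)
  degreeV-I-preserved i = +-cancelˡ-≡ (prefixSum (degreeV f ∘ I) (toℕ i)) _ _ (begin
    prefixSum (degreeV f ∘ I) (toℕ i) + degreeV f (I i)  ≡⟨ prefixSum-suc (degreeV f ∘ I) i ⟨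
    prefixSum (degreeV f ∘ I) (suc (toℕ i))              ≡⟨ prefixDegrees-preserved (suc i) ⟩
    prefixSum (degreeV g ∘ I) (suc (toℕ i))              ≡⟨ prefixSum-suc (degreeV g ∘ I) i ⟩
    prefixSum (degreeV g ∘ I) (toℕ i) + degreeV g (I i)  ≡⟨ cong (_+ degreeV g (I i)) below-i ⟨
    prefixSum (degreeV f ∘ I) (toℕ i) + degreeV g (I i)  ∎)
    where
    below-i : prefixSum (degreeV f ∘ I) (toℕ i) ≡ prefixSum (degreeV g ∘ I) (toℕ i)
    below-i = subst (λ k → prefixSum (degreeV f ∘ I) k ≡ prefixSum (degreeV g ∘ I) k)
                    (toℕ-inject₁ i) (prefixDegrees-preserved (inject₁ i))

functionGraph-≅⇒≗ : ∀ {m} {f g : Fin m → Fin m} → functionGraph f ≅ functionGraph g → f ≗ g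
functionGraph-≅⇒≗ {f = f} {g} iso i = degreeV-I-injective f g i (degreeV-I-preserved iso i)

mainTheorem2 : ∀ (k M : ℕ) → ∃[ n ] AtLeastIntervalClasses n (suc (M * (suc k ^ n)))
mainTheorem2 k M =
  order m , atLeastIntervalClasses functionGraph functionGraph-isInterval functionGraph-≅⇒≗ bound
  where
  open ≤-Reasoning
  C m : ℕ
  C = suc k ^ 6
  m = suc M * C
  1≤m : 1 ≤ m
  1≤m = ≤-trans (m^n>0 (suc k) 6) (m≤m+n C (M * C))
  bound : M * suc k ^ order m < m ^ m
  bound = begin-strict
    M * suc k ^ order m  ≤⟨ *-monoʳ-≤ M (^-monoʳ-≤ (suc k) (order≤6* 1≤m)) ⟩
    M * suc k ^ (6 * m)  ≡⟨ cong (M *_) (^-*-assoc (suc k) 6 m) ⟨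
    M * C ^ m            <⟨ M*C^m<m^m M C m {{m^n≢0 (suc k) 6}} ≤-refl ⟩
    m ^ m                ∎
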